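{- For every finite S5 regular reading event model $\mathbf{E}$, every event $e$ of $\mathbf{E}$, every atomic formula $p$, every term $\tau$ and all formulas $\varphi,\psi$ of $\mathcal{L}_{\mathfrak{E}5}$, the following formulas are true at every state of every S4-regular model and of every S5-regular model: (i) $[\mathbf{E},e]p\leftrightarrow p$; (ii) $[\mathbf{E},e]\neg\varphi\leftrightarrow\neg[\mathbf{E},e]\varphi$; (iii) $[\mathbf{E},e](\varphi\wedge\psi)\leftrightarrow([\mathbf{E},e]\varphi\wedge[\mathbf{E},e]\psi)$; (iv) $[\mathbf{E},e][\tau]\varphi\leftrightarrow\bigwedge_{e':\,eR^{\mathbf{E}}_\tau e'}[\gamma(e,\tau)][\mathbf{E},e']\varphi$.
   Context: Fix a finite set $\mathsf{AT}$ of atomic terms and a countable set $\mathsf{AF}$ of atomic formulas; terms $\mathsf{T}$: $\tau::=x\mid\tau+\tau\mid\tau\cdot\tau$ ($x\in\mathsf{AT}$). A model is $(W,\{R_\tau\mid\tau\in\mathsf{T}\},V)$, $R_\tau\subseteq W\times W$, $V:\mathsf{AF}\to\wp(W)$; regular if $R_{\sigma\cdot\tau}=R_\sigma\cap R_\tau$ and $R_{\sigma+\tau}=(R_\sigma\cup R_\tau)^\ast$ (reflexive transitive closure); S5-regular (S4-regular) if moreover all $R_\tau$ are equivalence relations (reflexive and transitive). Let $S5\mathsf{LCDK}$ be the system (over formulas $\varphi::=p\mid\neg\varphi\mid\varphi\vee\varphi\mid\langle\tau\rangle\varphi$, $[\tau]:=\neg\langle\tau\rangle\neg$) with propositional tautologies,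 Modus Ponens, Necessitation, and axioms K, T, 4, 5, dual, the lattice equivalences $\langle\alpha\rangle\varphi\leftrightarrow\langle\beta\rangle\varphi$ for idempotency, commutativity, associativity of $\cdot,+$ and absorption, FP $\langle\tau+\sigma\rangle\varphi\leftrightarrow(\varphi\vee\langle\tau\rangle\langle\tau+\sigma\rangle\varphi\vee\langle\sigma\rangle\langle\tau+\sigma\rangle\varphi)$, INDUC $[\tau+\sigma](\varphi\to([\tau]\varphi\wedge[\sigma]\varphi))\to(\varphi\to[\tau+\sigma]\varphi)$. Write $\tau\le\sigma$ iff $\langle\tau\rangle\varphi\to\langle\sigma\rangle\varphi$ is derivable in $S5\mathsf{LCDK}$, and $\tau\equiv\sigma$ iff both $\tau\le\sigma$ and $\sigma\le\tau$. An S5 regular reading event model is $\mathbf{E}=(E,\{R^{\mathbf{E}}_\tau\},S)$ with $E$ finite, each $R^{\mathbf{E}}_\tau$ an equivalence relation on $E$ satisfying the two regularity conditions, $S$ assigning to each $e$ a map $S(e):\mathsf{AT}\to\mathsf{T}$, and $eR^{\mathbf{E}}_xf\Rightarrow[S(e)](x)\equiv[S(f)](x)$. For a model $\mathbf{M}$, the product $\mathbf{M}\otimes\mathbf{E}$ has states $W\times E$, valuation inherited from $\mathbf{M}$ via the first coordinate, and relations: $(w,e)R^{\mathbf{M}\otimes\mathbf{E}}_x(w',e')$ iff $wR^{\mathbf{M}}_{[S(e)](x)}w'$ and $eR^{\mathbf{E}}_xe'$; $R^{\mathbf{M}\otimes\mathbf{E}}_{\sigma_1\cdot\sigma_2}=R^{\mathbf{M}\otimes\mathbf{E}}_{\sigma_1}\cap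 R^{\mathbf{M}\otimes\mathbf{E}}_{\sigma_2}$; $R^{\mathbf{M}\otimes\mathbf{E}}_{\sigma_1+\sigma_2}=(R^{\mathbf{M}\otimes\mathbf{E}}_{\sigma_1}\cup R^{\mathbf{M}\otimes\mathbf{E}}_{\sigma_2})^\ast$. The language $\mathcal{L}_{\mathfrak{E}5}$ extends the formulas above with $[\mathbf{E},e]\varphi$ for $\mathbf{E}$ a finite S5 regular reading event model and $e\in E$, with $\mathbf{M},w\models[\mathbf{E},e]\varphi$ iff $\mathbf{M}\otimes\mathbf{E},(w,e)\models\varphi$; other clauses standard ($w\models\langle\tau\rangle\varphi$ iff some $v$ with $wR_\tau v$ satisfies $\varphi$). The function $\gamma:E\times\mathsf{T}\to\mathsf{T}$ is: $\gamma(e,x)=[S(e)](x)$; $\gamma(e,\sigma_1\cdot\sigma_2)=\gamma(e,\sigma_1)\cdot\gamma(e,\sigma_2)$; $\gamma(e,\sigma_1+\sigma_2)=\sum_{f:\,eR^{\mathbf{E}}_{\sigma_1+\sigma_2}f}(\gamma(f,\sigma_1)+\gamma(f,\sigma_2))$, a finite $+$-sum. -}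

module Defs where

open import Data.Nat using (ℕ)
open import Data.Fin using (Fin)
open import Data.Bool using (Bool; true; false; T; not; _∧_; _∨_)
open import Data.List using (List; []; _∷_; map; allFin; filterᵇ)
open import Data.Product using (Σ; _×_; _,_)
open import Data.Sum using (_⊎_)
open import Data.Empty using (⊥)
open import Relation.Nullary using (¬_)
open import Relation.Binary.PropositionalEquality using (_≡_)
open import Relation.Binary.Structures using (IsEquivalence)
open import Relation.Binary.Construct.Closure.ReflexiveTransitive using (Star)
open import Function.Bundles using (_⇔_)

private variable n : ℕ

-- Terms over the finite set AT = Fin n of atomic terms
-- (_⊕_ is the paper's +, _⊙_ is the paper's ·)

infixl 6 _⊕_
infixl 7 _⊙_

data Term (n : ℕ) : Set where
  at  : Fin n → Term n
  _⊕_ : Term n → Term n → Term n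
  _⊙_ : Term n → Term n → Term n

data Form (n : ℕ) : Set where
  atom : ℕ → Form n
  ~_   : Form n → Form n
  _∨̇_  : Form n → Form n → Form n
  ◇    : Term n → Form n → Form n

□ : Term n → Form n → Form n
□ τ φ = ~ ◇ τ (~ φ)

_∧̇_ : Form n → Form n → Form n
φ ∧̇ ψ = ~ ((~ φ) ∨̇ (~ ψ))

_⇒̇_ : Form n → Form n → Form n
φ ⇒̇ ψ = (~ φ) ∨̇ ψ

_⇔̇_ : Form n → Form n → Form n
φ ⇔̇ ψ = (φ ⇒̇ ψ) ∧̇ (ψ ⇒̇ φ)

evalB : (Form n → Bool) → Form n → Bool
evalB v (atom p)  = v (atom p)
evalB v (~ φ)     = not (evalB v φ)
evalB v (φ ∨̇ ψ)   = evalB v φ ∨ evalB v ψ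
evalB v (◇ τ φ)   = v (◇ τ φ)

Taut : Form n → Set
Taut {n} φ = (v : Form n → Bool) → evalB v φ ≡ true

data LatEq {n : ℕ} : Term n → Term n → Set where
  idem⊙   : ∀ σ → LatEq (σ ⊙ σ) σ
  idem⊕   : ∀ σ → LatEq (σ ⊕ σ) σ
  comm⊙   : ∀ σ τ → LatEq (σ ⊙ τ) (τ ⊙ σ)
  comm⊕   : ∀ σ τ → LatEq (σ ⊕ τ) (τ ⊕ σ)
  assoc⊙  : ∀ σ τ ρ → LatEq ((σ ⊙ τ) ⊙ ρ) (σ ⊙ (τ ⊙ ρ))
  assoc⊕  : ∀ σ τ ρ → LatEq ((σ ⊕ τ) ⊕ ρ) (σ ⊕ (τ ⊕ ρ))
  absorb⊙ : ∀ σ τ → LatEq (σ ⊙ (σ ⊕ τ)) σ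
  absorb⊕ : ∀ σ τ → LatEq (σ ⊕ (σ ⊙ τ)) σ

infix 2 ⊢_
data ⊢_ {n : ℕ} : Form n → Set where
  taut  : ∀ {φ} → Taut φ → ⊢ φ
  mp    : ∀ {φ ψ} → ⊢ (φ ⇒̇ ψ) → ⊢ φ → ⊢ ψ
  nec   : ∀ {τ φ} → ⊢ φ → ⊢ □ τ φ
  axK   : ∀ τ φ ψ → ⊢ (□ τ (φ ⇒̇ ψ) ⇒̇ (□ τ φ ⇒̇ □ τ ψ))
  axT   : ∀ τ φ → ⊢ (□ τ φ ⇒̇ φ)
  ax4   : ∀ τ φ → ⊢ (□ τ φ ⇒̇ □ τ (□ τ φ))
  ax5   : ∀ τ φ → ⊢ (◇ τ φ ⇒̇ □ τ (◇ τ φ))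
  dual  : ∀ τ φ → ⊢ (◇ τ φ ⇔̇ (~ □ τ (~ φ)))
  lat   : ∀ {α β} → LatEq α β → ∀ φ → ⊢ (◇ α φ ⇔̇ ◇ β φ)
  fp    : ∀ τ σ φ → ⊢ (◇ (τ ⊕ σ) φ ⇔̇ ((φ ∨̇ ◇ τ (◇ (τ ⊕ σ) φ)) ∨̇ ◇ σ (◇ (τ ⊕ σ) φ)))
  induc : ∀ τ σ φ → ⊢ (□ (τ ⊕ σ) (φ ⇒̇ (□ τ φ ∧̇ □ σ φ)) ⇒̇ (φ ⇒̇ □ (τ ⊕ σ) φ))

_≤ₜ_ : Term n → Term n → Set
τ ≤ₜ σ = ∀ φ → ⊢ (◇ τ φ ⇒̇ ◇ σ φ)

_≡ₜ_ : Term n → Term n → Set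
τ ≡ₜ σ = (τ ≤ₜ σ) × (σ ≤ₜ τ)

record Model (n : ℕ) : Set₁ where
  field
    W : Set
    R : Term n → W → W → Set
    V : ℕ → W → Set
open Model public

Regular : Model n → Set
Regular M =
    (∀ σ τ w v → R M (σ ⊙ τ) w v ⇔ (R M σ w v × R M τ w v))
  × (∀ σ τ w v → R M (σ ⊕ τ) w v ⇔ Star (λ a b → R M σ a b ⊎ R M τ a b) w v)

S5Regular : Model n → Set
S5Regular M = Regular M × (∀ τ → IsEquivalence (R M τ))

S4Regular : Model n → Set
S4Regular M = Regular M
  × (∀ τ → (∀ {w} → R M τ w w) × (∀ {u v w} → R M τ u v → R M τ v w → R M τ u w))

-- S5 regular reading event models (finite carrier Fin size; relations on
-- a finite set are given by their Boolean characteristic functions)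

record EventModel (n : ℕ) : Set where
  field
    size    : ℕ
    rel     : Term n → Fin size → Fin size → Bool
    sub     : Fin size → Fin n → Term n
    isEquiv : ∀ τ → IsEquivalence (λ e f → T (rel τ e f))
    regDot  : ∀ σ τ e f → T (rel (σ ⊙ τ) e f) ⇔ (T (rel σ e f) × T (rel τ e f))
    regPlus : ∀ σ τ e f →
      T (rel (σ ⊕ τ) e f) ⇔ Star (λ a b → T (rel σ a b) ⊎ T (rel τ a b)) e f
    reading : ∀ x e f → T (rel (at x) e f) → sub e x ≡ₜ sub f x
open EventModel public

prodR : (M : Model n) (E : EventModel n) → Term n →
        (W M × Fin (size E)) → (W M × Fin (size E)) → Set
prodR M E (at x)  (w , e) (w' , e') = R M (sub E e x) w w' × T (rel E (at x) e e')
prodR M E (σ ⊙ τ) a b = prodR M E σ a b × prodR M E τ a b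
prodR M E (σ ⊕ τ) a b = Star (λ c d → prodR M E σ c d ⊎ prodR M E τ c d) a b

_⊗_ : Model n → EventModel n → Model n
M ⊗ E = record
  { W = W M × Fin (size E)
  ; R = prodR M E
  ; V = λ p we → V M p (Data.Product.proj₁ we)
  }

data EForm (n : ℕ) : Set where
  eatom : ℕ → EForm n
  e~_   : EForm n → EForm n
  _e∨_  : EForm n → EForm n → EForm n
  e◇    : Term n → EForm n → EForm n
  ev    : (E : EventModel n) → Fin (size E) → EForm n → EForm n

e□ : Term n → EForm n → EForm n
e□ τ φ = e~ e◇ τ (e~ φ)

_e∧_ : EForm n → EForm n → EForm n
φ e∧ ψ = e~ ((e~ φ) e∨ (e~ ψ))

_e⇒_ : EForm n → EForm n → EForm n
φ e⇒ ψ = (e~ φ) e∨ ψ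

_e⇔_ : EForm n → EForm n → EForm n
φ e⇔ ψ = (φ e⇒ ψ) e∧ (ψ e⇒ φ)

e⊤ : EForm n
e⊤ = e~ (eatom 0 e∧ (e~ eatom 0))

⋀ : List (EForm n) → EForm n
⋀ []           = e⊤
⋀ (φ ∷ [])     = φ
⋀ (φ ∷ ψ ∷ ψs) = φ e∧ ⋀ (ψ ∷ ψs)

_,_⊨_ : (M : Model n) → W M → EForm n → Set
M , w ⊨ eatom p   = V M p w
M , w ⊨ (e~ φ)    = ¬ (M , w ⊨ φ)
M , w ⊨ (φ e∨ ψ)  = (M , w ⊨ φ) ⊎ (M , w ⊨ ψ)
M , w ⊨ e◇ τ φ    = Σ (W M) (λ v → R M τ w v × (M , v ⊨ φ))
M , w ⊨ ev E e φ  = (M ⊗ E) , (w , e) ⊨ φ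

-- nonempty finite +-sum; the first argument is returned only for an
-- empty list (which never happens below, since R^E is reflexive)
sumNE : Term n → List (Term n) → Term n
sumNE t []       = t
sumNE t (u ∷ us) = t ⊕ sumNE u us

sumT : Term n → List (Term n) → Term n
sumT d []       = d
sumT d (t ∷ ts) = sumNE t ts

γ : (E : EventModel n) → Fin (size E) → Term n → Term n
γ E e (at x)  = sub E e x
γ E e (σ ⊙ τ) = γ E e σ ⊙ γ E e τ
γ E e (σ ⊕ τ) = sumT (γ E e σ ⊕ γ E e τ)
  (map (λ f → γ E f σ ⊕ γ E f τ) (filterᵇ (rel E (σ ⊕ τ) e) (allFin (size E))))

related : (E : EventModel n) → Fin (size E) → Term n → List (Fin (size E))
related E e τ = filterᵇ (rel E τ e) (allFin (size E))

{-# OPTIONS --safe #-}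
module Submission where

-- (i)–(iii) hold by the very definition of satisfaction in M ⊗ E.  For (iv),
-- the point is that in the product of an S4-regular model M with E,
--   (w , e) R_τ (v , e')  iff  w R_{γ(e,τ)} v  and  e R^E_τ e',
-- by induction on τ.  For τ = σ₁ + σ₂: along a path of σ₁/σ₂-steps the event
-- stays in the (σ₁+σ₂)-class of e, and a step taken at event f is a step of the
-- summand γ(f,σ₁) + γ(f,σ₂) of γ(e,σ₁+σ₂).  Conversely, a step of that summand
-- is simulated in M ⊗ E by moving the event from e to f at a fixed world
-- (reflexivity of M), moving the world at event f, and moving the event back.

open import Defs
open import Data.Nat using (ℕ)
open import Data.Fin using (Fin)
open import Data.List using (List; []; _∷_; map; allFin)
open import Data.List.Relation.Unary.Any using (Any; here; there)
open import Data.List.Relation.Unary.Any.Properties using (map⁻)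
open import Data.List.Membership.Propositional using (_∈_; find; lose)
open import Data.List.Membership.Propositional.Properties
  using (∈-filter⁺; ∈-filter⁻; ∈-map⁺; ∈-map⁻; ∈-allFin)
open import Data.Product using (Σ; _×_; _,_; proj₁; proj₂)
open import Data.Sum using (_⊎_; inj₁; inj₂)
import Data.Sum as Sum
open import Data.Bool using (T)
open import Data.Bool.Properties using (T?)
open import Function using (id; _∘_)
open import Function.Bundles using (Equivalence; _⇔_; mk⇔)
open import Relation.Nullary using (¬_)
open import Relation.Binary.PropositionalEquality using (refl)
open import Relation.Binary.Structures using (IsEquivalence)
open import Relation.Binary.Construct.Closure.ReflexiveTransitive
  using (Star; ε; _◅_; _◅◅_; gmap; kleisliStar)

open Equivalence using (to; from)

private variable
  n : ℕ
  σ τ : Term n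

S5Regular⇒S4Regular : {M : Model n} → S5Regular M → S4Regular M
S5Regular⇒S4Regular (regular , equiv) =
  regular , λ τ → IsEquivalence.refl (equiv τ) , IsEquivalence.trans (equiv τ)

module EventRelations (E : EventModel n) where

  private variable e f g : Fin (size E)

  rel-refl : T (rel E τ e e)
  rel-refl {τ = τ} = IsEquivalence.refl (isEquiv E τ)

  rel-sym : T (rel E τ e f) → T (rel E τ f e)
  rel-sym {τ = τ} = IsEquivalence.sym (isEquiv E τ)

  rel-trans : T (rel E τ e f) → T (rel E τ f g) → T (rel E τ e g)
  rel-trans {τ = τ} = IsEquivalence.trans (isEquiv E τ)

  rel-⊙⁺ : T (rel E σ e f) × T (rel E τ e f) → T (rel E (σ ⊙ τ) e f)
  rel-⊙⁺ {σ = σ} {τ = τ} = from (regDot E σ τ _ _)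

  rel-⊙⁻ : T (rel E (σ ⊙ τ) e f) → T (rel E σ e f) × T (rel E τ e f)
  rel-⊙⁻ {σ = σ} {τ = τ} = to (regDot E σ τ _ _)

  rel-⊕⁺ : T (rel E σ e f) ⊎ T (rel E τ e f) → T (rel E (σ ⊕ τ) e f)
  rel-⊕⁺ {σ = σ} {τ = τ} s = from (regPlus E σ τ _ _) (s ◅ ε)

  rel-⊕⁻ : T (rel E (σ ⊕ τ) e f) →
           Star (λ a b → T (rel E σ a b) ⊎ T (rel E τ a b)) e f
  rel-⊕⁻ {σ = σ} {τ = τ} = to (regPlus E σ τ _ _)

  ∈-related⁺ : ∀ τ {e f} → T (rel E τ e f) → f ∈ related E e τ
  ∈-related⁺ τ {e} {f} = ∈-filter⁺ (λ x → T? (rel E τ e x)) (∈-allFin f)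

  ∈-related⁻ : ∀ τ {e f} → f ∈ related E e τ → T (rel E τ e f)
  ∈-related⁻ τ {e} =
    proj₂ ∘ ∈-filter⁻ (λ x → T? (rel E τ e x)) {xs = allFin (size E)}

module RegularRelations {M : Model n} (regular : Regular M) where

  private variable
    a b : W M
    u : Term n
    us : List (Term n)

  R-⊙⁺ : R M σ a b × R M τ a b → R M (σ ⊙ τ) a b
  R-⊙⁺ {σ = σ} {τ = τ} = from (proj₁ regular σ τ _ _)

  R-⊙⁻ : R M (σ ⊙ τ) a b → R M σ a b × R M τ a b
  R-⊙⁻ {σ = σ} {τ = τ} = to (proj₁ regular σ τ _ _)

  R-⊕⁺ : R M σ a b ⊎ R M τ a b → R M (σ ⊕ τ) a b
  R-⊕⁺ {σ = σ} {τ = τ} r = from (proj₂ regular σ τ _ _) (r ◅ ε)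

  R-⊕⁻ : R M (σ ⊕ τ) a b → Star (λ x y → R M σ x y ⊎ R M τ x y) a b
  R-⊕⁻ {σ = σ} {τ = τ} = to (proj₂ regular σ τ _ _)

  R-sumNE⁺ : Any (λ t → R M t a b) (u ∷ us) → R M (sumNE u us) a b
  R-sumNE⁺ {us = []}     (here r)  = r
  R-sumNE⁺ {us = _ ∷ _}  (here r)  = R-⊕⁺ (inj₁ r)
  R-sumNE⁺ {us = _ ∷ _}  (there r) = R-⊕⁺ (inj₂ (R-sumNE⁺ r))

  R-sumNE⁻ : R M (sumNE u us) a b →
             Star (λ x y → Any (λ t → R M t x y) (u ∷ us)) a b
  R-sumNE⁻ {us = []}    r = here r ◅ ε
  R-sumNE⁻ {u = u} {us = u′ ∷ us} r = kleisliStar id summand (R-⊕⁻ r)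
    where
    summand : ∀ {x y} → R M u x y ⊎ R M (sumNE u′ us) x y →
              Star (λ x y → Any (λ t → R M t x y) (u ∷ u′ ∷ us)) x y
    summand (inj₁ r) = here r ◅ ε
    summand (inj₂ r) = gmap id there (R-sumNE⁻ r)

  R-sumT⁺ : ∀ {d L} → Any (λ t → R M t a b) L → R M (sumT d L) a b
  R-sumT⁺ {L = _ ∷ _} = R-sumNE⁺

  -- The default d is the value of an empty sum, hence may occur as a step.
  R-sumT⁻ : ∀ {d L} → R M (sumT d L) a b →
            Star (λ x y → Any (λ t → R M t x y) (d ∷ L)) a b
  R-sumT⁻ {L = []}    r = here r ◅ ε
  R-sumT⁻ {L = _ ∷ _} r = gmap id there (R-sumNE⁻ r)

module Product (M : Model n) (S4 : S4Regular M) (E : EventModel n) where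

  open EventRelations E
  open RegularRelations {M = M} (proj₁ S4)

  private
    Ev = Fin (size E)

    R-refl : ∀ {τ w} → R M τ w w
    R-refl {τ = τ} = proj₁ (proj₂ S4 τ)

    R-trans : ∀ {τ u v w} → R M τ u v → R M τ v w → R M τ u w
    R-trans {τ = τ} = proj₂ (proj₂ S4 τ)

  Summand : Term n → Term n → Ev → W M → W M → Set
  Summand σ τ e x y =
    Σ Ev λ f → T (rel E (σ ⊕ τ) e f) × R M (γ E f σ ⊕ γ E f τ) x y

  Summand⇒γ : ∀ {e x y} → Summand σ τ e x y → R M (γ E e (σ ⊕ τ)) x y
  Summand⇒γ {σ = σ} {τ = τ} (f , h , r) =
    R-sumT⁺ (lose (∈-map⁺ (λ f → γ E f σ ⊕ γ E f τ) (∈-related⁺ (σ ⊕ τ) h)) r)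

  γ⇒Summands : ∀ {e x y} → R M (γ E e (σ ⊕ τ)) x y → Star (Summand σ τ e) x y
  γ⇒Summands {σ = σ} {τ = τ} {e} r = gmap id summand (R-sumT⁻ r)
    where
    summand : ∀ {x y} →
      Any (λ t → R M t x y) (map (λ f → γ E f σ ⊕ γ E f τ) (e ∷ related E e (σ ⊕ τ))) →
      Summand σ τ e x y
    summand (here r)  = e , rel-refl , r
    summand (there r) =
      let f , f∈ , r = find (map⁻ r) in f , ∈-related⁻ (σ ⊕ τ) f∈ , r

  private
    ProdStep : Term n → Term n → W M × Ev → W M × Ev → Set
    ProdStep σ τ a b = prodR M E σ a b ⊎ prodR M E τ a b

  prodR⇒γ : ∀ τ {w e v e'} →
            prodR M E τ (w , e) (v , e') → R M (γ E e τ) w v × T (rel E τ e e')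
  prodR⇒γ (at x) p = p
  prodR⇒γ (σ ⊙ τ) (p , q) =
    let r₁ , h₁ = prodR⇒γ σ p
        r₂ , h₂ = prodR⇒γ τ q
    in R-⊙⁺ (r₁ , r₂) , rel-⊙⁺ (h₁ , h₂)
  prodR⇒γ (σ ⊕ τ) {e = e} path = along rel-refl path
    where
    step : ∀ {u f u' f'} → ProdStep σ τ (u , f) (u' , f') →
           R M (γ E f σ ⊕ γ E f τ) u u' × T (rel E (σ ⊕ τ) f f')
    step (inj₁ p) = let r , h = prodR⇒γ σ p in R-⊕⁺ (inj₁ r) , rel-⊕⁺ (inj₁ h)
    step (inj₂ p) = let r , h = prodR⇒γ τ p in R-⊕⁺ (inj₂ r) , rel-⊕⁺ (inj₂ h)

    along : ∀ {u f v f'} → T (rel E (σ ⊕ τ) e f) →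
            Star (ProdStep σ τ) (u , f) (v , f') →
            R M (γ E e (σ ⊕ τ)) u v × T (rel E (σ ⊕ τ) e f')
    along h ε = R-refl , h
    along h (s ◅ rest) =
      let r , hff' = step s
          r' , h' = along (rel-trans h hff') rest
      in R-trans (Summand⇒γ (_ , h , r)) r' , h'

  γ⇒prodR : ∀ τ {w e v e'} →
            R M (γ E e τ) w v → T (rel E τ e e') → prodR M E τ (w , e) (v , e')
  γ⇒prodR (at x) r h = r , h
  γ⇒prodR (σ ⊙ τ) r h =
    let r₁ , r₂ = R-⊙⁻ r
        h₁ , h₂ = rel-⊙⁻ h
    in γ⇒prodR σ r₁ h₁ , γ⇒prodR τ r₂ h₂
  γ⇒prodR (σ ⊕ τ) {e = e} r h =
    kleisliStar (_, e) detour (γ⇒Summands r) ◅◅ moveEvent h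
    where
    moveEvent : ∀ {u f f'} → T (rel E (σ ⊕ τ) f f') →
                Star (ProdStep σ τ) (u , f) (u , f')
    moveEvent {u} h =
      gmap (u ,_) (Sum.map (γ⇒prodR σ R-refl) (γ⇒prodR τ R-refl)) (rel-⊕⁻ h)

    moveWorld : ∀ {u u' f} → R M (γ E f σ ⊕ γ E f τ) u u' →
                Star (ProdStep σ τ) (u , f) (u' , f)
    moveWorld {f = f} r = gmap (_, f)
      (Sum.map (λ r → γ⇒prodR σ r rel-refl) (λ r → γ⇒prodR τ r rel-refl)) (R-⊕⁻ r)

    detour : ∀ {x y} → Summand σ τ e x y → Star (ProdStep σ τ) (x , e) (y , e)
    detour (f , h , r) = moveEvent h ◅◅ moveWorld r ◅◅ moveEvent (rel-sym h)

  prodR⇔γ : ∀ τ {w e v e'} →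
            prodR M E τ (w , e) (v , e') ⇔ (R M (γ E e τ) w v × T (rel E τ e e'))
  prodR⇔γ τ = mk⇔ (prodR⇒γ τ) λ (r , h) → γ⇒prodR τ r h

module _ {M : Model n} {w : W M} where

  ⊨-⇔ : ∀ A B → (M , w ⊨ A → M , w ⊨ B) → (M , w ⊨ B → M , w ⊨ A) →
        M , w ⊨ (A e⇔ B)
  ⊨-⇔ _ _ A⇒B B⇒A (inj₁ k) = k (inj₁ λ a → k (inj₂ (A⇒B a)))
  ⊨-⇔ _ _ A⇒B B⇒A (inj₂ k) = k (inj₁ λ b → k (inj₂ (B⇒A b)))

  ⊨-e⊤ : M , w ⊨ e⊤
  ⊨-e⊤ k = k (inj₂ λ ¬p → k (inj₁ ¬p))

  ⊨-⋀⁺ : ∀ φs → (∀ {φ} → φ ∈ φs → M , w ⊨ φ) → M , w ⊨ ⋀ φs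
  ⊨-⋀⁺ []           _  = ⊨-e⊤
  ⊨-⋀⁺ (φ ∷ [])     ⊨φs = ⊨φs (here refl)
  ⊨-⋀⁺ (φ ∷ ψ ∷ ψs) ⊨φs (inj₁ ¬φ) = ¬φ (⊨φs (here refl))
  ⊨-⋀⁺ (φ ∷ ψ ∷ ψs) ⊨φs (inj₂ ¬ψs) = ¬ψs (⊨-⋀⁺ (ψ ∷ ψs) (⊨φs ∘ there))

  ⊨-⋀⁻ : ∀ φs {φ} → M , w ⊨ ⋀ φs → φ ∈ φs → ¬ ¬ (M , w ⊨ φ)
  ⊨-⋀⁻ (φ ∷ [])     ⊨φ (here refl) ¬φ = ¬φ ⊨φ
  ⊨-⋀⁻ (φ ∷ ψ ∷ ψs) ⊨φs (here refl) ¬φ = ⊨φs (inj₁ ¬φ)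
  ⊨-⋀⁻ (φ ∷ ψ ∷ ψs) ⊨φs (there m) ¬φ =
    ⊨φs (inj₂ λ ⊨ψs → ⊨-⋀⁻ (ψ ∷ ψs) ⊨ψs m ¬φ)

mainTheorem4 : {n : ℕ} (E : EventModel n) (e : Fin (size E)) (p : ℕ) (τ : Term n)
    (φ ψ : EForm n) (M : Model n) → (S4Regular M ⊎ S5Regular M) → (w : W M) →
      (M , w ⊨ (ev E e (eatom p) e⇔ eatom p))
    × (M , w ⊨ (ev E e (e~ φ) e⇔ (e~ ev E e φ)))
    × (M , w ⊨ (ev E e (φ e∧ ψ) e⇔ (ev E e φ e∧ ev E e ψ)))
    × (M , w ⊨ (ev E e (e□ τ φ) e⇔ ⋀ (map (λ e' → e□ (γ E e τ) (ev E e' φ)) (related E e τ))))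
mainTheorem4 E e p τ φ ψ M S4⊎S5 w =
    ⊨-⇔ {M = M} {w} (ev E e (eatom p)) (eatom p) id id
  , ⊨-⇔ (ev E e (e~ φ)) (e~ ev E e φ) id id
  , ⊨-⇔ (ev E e (φ e∧ ψ)) (ev E e φ e∧ ev E e ψ) id id
  , ⊨-⇔ (ev E e (e□ τ φ)) (⋀ (map F (related E e τ))) □⇒⋀ ⋀⇒□
  where
  open Product M (Sum.[ id , S5Regular⇒S4Regular {M = M} ] S4⊎S5) E
  open EventRelations E using (∈-related⁺; ∈-related⁻)

  F : Fin (size E) → EForm _
  F e' = e□ (γ E e τ) (ev E e' φ)

  □-conjunct : M , w ⊨ ev E e (e□ τ φ) →
               ∀ {χ} → χ ∈ map F (related E e τ) → M , w ⊨ χ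
  □-conjunct ⊨□ m with ∈-map⁻ F m
  ... | e' , e'∈ , refl = λ (v , r , ¬φ) →
    ⊨□ ((v , e') , from (prodR⇔γ τ) (r , ∈-related⁻ τ e'∈) , ¬φ)

  □⇒⋀ : M , w ⊨ ev E e (e□ τ φ) → M , w ⊨ ⋀ (map F (related E e τ))
  □⇒⋀ ⊨□ = ⊨-⋀⁺ _ (□-conjunct ⊨□)

  ⋀⇒□ : M , w ⊨ ⋀ (map F (related E e τ)) → M , w ⊨ ev E e (e□ τ φ)
  ⋀⇒□ ⊨⋀ ((v , e') , q , ¬φ) =
    let r , h = to (prodR⇔γ τ) q
    in ⊨-⋀⁻ _ ⊨⋀ (∈-map⁺ F (∈-related⁺ τ h)) λ ⊨F → ⊨F (v , r , ¬φ)
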